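{- (a) Let $\langle K,R,\vDash\rangle$ be a Kripke model such that for every $k\in K$: $xRx$ for all $x\in R^+[k]$, and $\vDash$ restricted to $R^+[k]$ is formula persistent (for all $x,y\in R^+[k]$ with $xRy$ and every formula $\chi$, $x\vDash\chi$ implies $y\vDash\chi$). Then for all formulas $\varphi,\psi$, the formula $(\varphi\&[\varphi\rightarrow\psi])\rightarrow(\psi\&[\psi\rightarrow\varphi])$ holds at every node of this model. (b) Conversely, suppose the axiom scheme $(\varphi\&[\varphi\rightarrow\psi])\rightarrow(\psi\&[\psi\rightarrow\varphi])$ is satisfied in a Kripke frame $\langle K,R\rangle$ (every instance holds at every node of every Kripke model on the frame). Then for every $k\in K$, $xRx$ holds for all $x\in R^+[k]$; and every Kripke model on this frame in which that scheme holds at every node has a satisfaction relation whose restriction to $R^+[k]$ is formula persistent for every $k\in K$.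
   Context: Formulas are built from a countably infinite set of atoms and the constant $\bot$ (falsity) using the binary connectives $\&$ and $\rightarrow$. A Kripke frame is a pair $\langle K,R\rangle$ with $R\subseteq K\times K$ an arbitrary binary relation; a Kripke model on it is $\langle K,R,\vDash\rangle$ with $\vDash\subseteq K\times\mathsf{Atoms}$ arbitrary, extended to formulas by: $k\nvDash\bot$; $k\vDash\varphi\&\psi$ iff $k\vDash\varphi$ and $k\vDash\psi$; $k\vDash\varphi\rightarrow\psi$ iff for every $k'$ with $kRk'$, if $k'\vDash\varphi$ then $k'\vDash\psi$. For $k\in K$, $R^n[k]=\{x\mid \exists y_1,\dots,y_{n-1}\,(kRy_1R\cdots Ry_{n-1}Rx)\}$ and $R^+[k]=\bigcup_{n\ge1}R^n[k]$. -}

module Defs where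

open import Data.Nat using (ℕ)
open import Data.Empty using (⊥)
open import Data.Product using (_×_)
open import Relation.Binary.Construct.Closure.Transitive using (TransClosure)

data Formula : Set where
  atom : ℕ → Formula
  falsum : Formula
  _&_ : Formula → Formula → Formula
  _⇒_ : Formula → Formula → Formula

infixr 6 _&_
infixr 5 _⇒_

record Frame : Set₁ where
  field
    K : Set
    R : K → K → Set

-- A Kripke model on a frame: an arbitrary relation between nodes and atoms.
Valuation : Frame → Set₁
Valuation F = Frame.K F → ℕ → Set

Sat : (F : Frame) → Valuation F → Frame.K F → Formula → Set
Sat F V k (atom n) = V k n
Sat F V k falsum = ⊥
Sat F V k (φ & ψ) = Sat F V k φ × Sat F V k ψ
Sat F V k (φ ⇒ ψ) = ∀ k' → Frame.R F k k' → Sat F V k' φ → Sat F V k' ψ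

R⁺ : (F : Frame) → Frame.K F → Frame.K F → Set
R⁺ F = TransClosure (Frame.R F)

Ax : Formula → Formula → Formula
Ax φ ψ = (φ & (φ ⇒ ψ)) ⇒ (ψ & (ψ ⇒ φ))

ReflOnReach : Frame → Set
ReflOnReach F = ∀ k x → R⁺ F k x → Frame.R F x x

PersistentOnReach : (F : Frame) → Valuation F → Set
PersistentOnReach F V = ∀ k x y → R⁺ F k x → R⁺ F k y → Frame.R F x y →
  ∀ χ → Sat F V x χ → Sat F V y χ

AxValidModel : (F : Frame) → Valuation F → Set
AxValidModel F V = ∀ φ ψ k → Sat F V k (Ax φ ψ)

AxValidFrame : Frame → Set₁
AxValidFrame F = ∀ (V : Valuation F) → AxValidModel F V

module Submission where

-- (a) A premise φ & [φ → ψ] is evaluated at an R-successor of the current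
-- node, hence inside R⁺[k]: reflexivity there yields ψ, and persistence
-- carries φ forward to every further successor, which gives ψ → φ.
-- (b) Every node of R⁺[k] has an R-predecessor z, and instances of the
-- scheme at z test the node itself. With ⊤ := ⊥ → ⊥, the instance
-- (⊤ & [⊤ → p]) → p under the valuation "p holds at the R-successors of x"
-- forces x R x, and the instance (χ & [χ → ⊤]) → [⊤ → χ] says that χ
-- persists from x to its successors.

open import Defs
open import Data.Product using (_×_; _,_; ∃; proj₁; proj₂)
open import Relation.Binary.Construct.Closure.Transitive using (TransClosure; [_]; _∷_)

module _ {A : Set} {_∼_ : A → A → Set} where

  TransClosure⇒∃-last-step : ∀ {x y} → TransClosure _∼_ x y → ∃ λ z → z ∼ y
  TransClosure⇒∃-last-step {x} [ x∼y ]  = x , x∼y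
  TransClosure⇒∃-last-step (_ ∷ y∼⁺z)   = TransClosure⇒∃-last-step y∼⁺z

verum : Formula
verum = falsum ⇒ falsum

module _ (F : Frame) where
  open Frame F

  Sat-verum : (V : Valuation F) (k : K) → Sat F V k verum
  Sat-verum V k _ _ ()

  Ax-sound : (V : Valuation F) → ReflOnReach F → PersistentOnReach F V →
             ∀ φ ψ k → Sat F V k (Ax φ ψ)
  Ax-sound V refl persist φ ψ k x k∼x (x⊨φ , x⊨φ⇒ψ) =
    x⊨φ⇒ψ x (refl k x [ k∼x ]) x⊨φ ,
    λ y x∼y _ → persist k x y [ k∼x ] (k∼x ∷ [ x∼y ]) x∼y φ x⊨φ

  AxValidFrame⇒refl-on-successors : AxValidFrame F → ∀ {z x} → R z x → R x x
  AxValidFrame⇒refl-on-successors valid {z} {x} z∼x =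
    proj₁ (valid successorOf-x verum (atom 0) z x z∼x
             (Sat-verum successorOf-x x , λ _ x∼w _ → x∼w))
    where
    successorOf-x : Valuation F
    successorOf-x w _ = R x w

  AxValidModel⇒persistent-on-successors :
    (V : Valuation F) → AxValidModel F V →
    ∀ {z x y} → R z x → R x y → ∀ χ → Sat F V x χ → Sat F V y χ
  AxValidModel⇒persistent-on-successors V valid {z} {x} {y} z∼x x∼y χ x⊨χ =
    proj₂ (valid χ verum z x z∼x (x⊨χ , λ w _ _ → Sat-verum V w))
      y x∼y (Sat-verum V y)

theorem3 :
    ((F : Frame) (V : Valuation F) → ReflOnReach F → PersistentOnReach F V →
       ∀ φ ψ k → Sat F V k (Ax φ ψ))
    ×
    ((F : Frame) → AxValidFrame F →
       ReflOnReach F × ((V : Valuation F) → AxValidModel F V → PersistentOnReach F V))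
theorem3 = Ax-sound , λ F valid →
  (λ k x k∼⁺x →
     AxValidFrame⇒refl-on-successors F valid (proj₂ (TransClosure⇒∃-last-step k∼⁺x))) ,
  (λ V validV k x y k∼⁺x _ →
     AxValidModel⇒persistent-on-successors F V validV
       (proj₂ (TransClosure⇒∃-last-step k∼⁺x)))
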